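{- Let $G=(V,E)$ be a finite simple graph and $(T,r,\rho)$ a tree-layout of $G$. The following are equivalent: (1) $(T,r,\rho)$ is an indifference tree-layout; (2) for every vertex $x$, the node set $\rho(N[x])$ induces a connected subtree of $T$; (3) for every maximal clique $K$ of $G$, the node set $\rho(K)$ is the node set of a subpath of some path of $T$ from $r$ to a leaf (i.e. the vertices of $K$ appear consecutively on a path from $r$); (4) for every pair of vertices $x,y$ with $x\prec y$, we have $N(y)\cap A(x)\subseteq N(x)\cap A(x)$ and $N(x)\cap D(y)\subseteq N(y)\cap D(y)$.
   Context: $N(v)$ denotes the open neighbourhood and $N[v]=N(v)\cup\{v\}$. A tree-layout of $G=(V,E)$ is a triple $(T,r,\rho)$ where $T$ is a tree with $|V|$ nodes rooted at $r$ and $\rho:V\to V(T)$ is a bijection such that for every edge $xy\in E$, $\rho(x)$ is an ancestor of $\rho(y)$ or vice versa. Write $u\prec v$ if $\rho(u)$ is a proper ancestor of $\rho(v)$; $A(v)=\{u: u\prec v\}$ and $D(v)=\{u: v\prec u\}$. An indifference tree-layout is a tree-layout with no three vertices $x\prec y\prec z$ such that $xz\in E$ and ($xy\notin E$ or $yz\notin E$). -}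

module Defs where

open import Data.Nat using (ℕ)
open import Data.Fin using (Fin)
open import Data.Bool using (Bool; true; false)
open import Data.Maybe using (Maybe; just; nothing)
open import Data.Product using (Σ; ∃; _×_; _,_)
open import Data.Sum using (_⊎_)
open import Relation.Binary.PropositionalEquality using (_≡_; _≢_)
open import Relation.Nullary using (¬_)
open import Function.Bundles using (_⇔_)
open import Function.Definitions using (Bijective)
open import Data.Fin.Subset using (Subset; _∈_; _∉_; _⊆_)

record Graph (n : ℕ) : Set where
  field
    adj     : Fin n → Fin n → Bool
    sym     : ∀ x y → adj x y ≡ adj y x
    irrefl  : ∀ x → adj x x ≡ false

data Anc {m : ℕ} (parent : Fin m → Maybe (Fin m)) : Fin m → Fin m → Set where
  step  : ∀ {a b} → parent b ≡ just a → Anc parent a b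
  trans : ∀ {a p b} → Anc parent a p → parent b ≡ just p → Anc parent a b

AncEq : {m : ℕ} (parent : Fin m → Maybe (Fin m)) → Fin m → Fin m → Set
AncEq parent a b = a ≡ b ⊎ Anc parent a b

-- A rooted tree: the root has no parent and the root is an ancestor-or-equal
-- of every node (so following parents from any node reaches the root;
-- in particular there are no cycles and the tree is connected).
record RootedTree (m : ℕ) : Set where
  field
    parent      : Fin m → Maybe (Fin m)
    root        : Fin m
    root-parent : parent root ≡ nothing
    reach       : ∀ t → AncEq parent root t

  _⊏_ : Fin m → Fin m → Set
  a ⊏ b = Anc parent a b

  _⊑_ : Fin m → Fin m → Set
  a ⊑ b = AncEq parent a b

  TEdge : Fin m → Fin m → Set
  TEdge a b = parent a ≡ just b ⊎ parent b ≡ just a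

  IsLeaf : Fin m → Set
  IsLeaf l = ∀ t → parent t ≢ just l

  data WalkIn (S : Fin m → Set) : Fin m → Fin m → Set where
    here  : ∀ {a} → S a → WalkIn S a a
    cons  : ∀ {a b c} → S a → TEdge a b → WalkIn S b c → WalkIn S a c

  InducesConnected : (Fin m → Set) → Set
  InducesConnected S = ∃ S × (∀ a b → S a → S b → WalkIn S a b)

  IsRootLeafSubpath : (Fin m → Set) → Set
  IsRootLeafSubpath S =
    Σ (Fin m) λ l → Σ (Fin m) λ a → Σ (Fin m) λ b →
      IsLeaf l × a ⊑ b × b ⊑ l × (∀ t → S t ⇔ (a ⊑ t × t ⊑ b))

record TreeLayout {n : ℕ} (G : Graph n) : Set where
  open Graph G
  field
    T      : RootedTree n
    ρ      : Fin n → Fin n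
    ρ-bij  : Bijective _≡_ _≡_ ρ
  open RootedTree T public
  field
    edges-comparable : ∀ x y → adj x y ≡ true → (ρ x ⊑ ρ y) ⊎ (ρ y ⊑ ρ x)

  _≺_ : Fin n → Fin n → Set
  u ≺ v = ρ u ⊏ ρ v

  Image : (Fin n → Set) → Fin n → Set
  Image K t = ∃ λ v → K v × ρ v ≡ t

module _ {n : ℕ} (G : Graph n) where
  open Graph G

  ClosedNbhd : Fin n → Fin n → Set
  ClosedNbhd x v = v ≡ x ⊎ adj x v ≡ true

  IsClique : Subset n → Set
  IsClique K = ∀ x y → x ∈ K → y ∈ K → x ≢ y → adj x y ≡ true

  IsMaximalClique : Subset n → Set
  IsMaximalClique K = IsClique K × (∀ K′ → IsClique K′ → K ⊆ K′ → K′ ⊆ K)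

  module _ (L : TreeLayout G) where
    open TreeLayout L

    IsIndifference : Set
    IsIndifference = ∀ x y z → x ≺ y → y ≺ z → adj x z ≡ true →
                       adj x y ≡ true × adj y z ≡ true

    Cond2 : Set
    Cond2 = ∀ x → InducesConnected (Image (ClosedNbhd x))

    Cond3 : Set
    Cond3 = ∀ K → IsMaximalClique K → IsRootLeafSubpath (Image (λ v → v ∈ K))

    Cond4 : Set
    Cond4 = ∀ x y → x ≺ y →
              (∀ z → (adj y z ≡ true × z ≺ x) → (adj x z ≡ true × z ≺ x)) ×
              (∀ z → (adj x z ≡ true × y ≺ z) → (adj y z ≡ true × y ≺ z))

-- (1) ⇔ (4) is a rewording of the definition. Under (1), a neighbour v of x is joined to x
-- by the tree path between ρ x and ρ v, and every vertex on it is again a neighbour of x,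
-- which gives (2); conversely a walk inside ρ(N[x]) from ρ x down to ρ z passes through
-- every node between them. A clique is a chain for the ancestor order, and under (1) every
-- vertex between its lowest and highest member is adjacent to all of it, so a maximal clique
-- is a whole interval of a root-to-leaf path; conversely a maximal clique containing x and z
-- is such an interval and hence contains y.

{-# OPTIONS --safe #-}
module Submission where

open import Defs
open import Data.Nat using (ℕ; zero; suc; s≤s; _<_)
open import Data.Nat.GeneralisedArithmetic using (fold)
open import Data.Nat.Properties using (n<1+n; m≤n⇒m<n∨m≡n)
open import Data.Fin using (Fin; toℕ; _≟_)
open import Data.Fin.Properties using (any?; all?; pigeonhole)
open import Data.Fin.Subset using (Subset; _∈_; _⊆_; _∪_; ⁅_⁆)
open import Data.Fin.Subset.Properties
  using (_∈?_; x∈⁅x⁆; x∈⁅y⁆⇒x≡y; x∈p∪q⁻; x∈p∪q⁺; p⊆p∪q)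
open import Data.Bool using (true)
import Data.Bool.Properties as Bool
open import Data.Maybe using (just)
open import Data.Maybe.Properties using (just-injective) renaming (≡-dec to Maybe-≡-dec)
open import Data.Product using (Σ; ∃; ∃₂; _×_; _,_; proj₁; proj₂)
open import Data.Sum using (_⊎_; inj₁; inj₂; [_,_])
import Data.Sum as Sum
open import Data.Empty using (⊥-elim)
open import Data.List using (List; []; _∷_; allFin)
open import Data.List.Relation.Unary.Any using (here; there)
import Data.List.Membership.Propositional as List
open import Data.List.Membership.Propositional.Properties using (∈-allFin)
open import Relation.Binary.PropositionalEquality as Eq using (_≡_; _≢_; refl; sym; subst)
open import Relation.Binary.Definitions using (Reflexive; Transitive)
open import Relation.Nullary using (¬_; Dec; yes; no)
open import Relation.Nullary.Decidable using (_→-dec_; _⊎-dec_)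
open import Relation.Unary using (Decidable)
open import Function using (id; _∘_)
open import Function.Bundles using (_⇔_; mk⇔; Equivalence)

Greatest : ∀ {k} → (Fin k → Set) → (Fin k → Fin k → Set) → Set
Greatest {k} P R = Σ (Fin k) λ m → P m × (∀ x → P x → R x m)

greatest-or-empty : ∀ {k} (P : Fin k → Set) → Decidable P → (R : Fin k → Fin k → Set) →
  Reflexive R → Transitive R → (∀ x y → P x → P y → R x y ⊎ R y x) →
  (∀ x → ¬ P x) ⊎ Greatest P R
greatest-or-empty {zero} P P? R refl′ trans′ total = inj₁ (λ ())
greatest-or-empty {suc k} P P? R refl′ trans′ total
  with greatest-or-empty (P ∘ Fin.suc) (P? ∘ Fin.suc) (λ x y → R (Fin.suc x) (Fin.suc y))
         refl′ trans′ (λ x y → total (Fin.suc x) (Fin.suc y)) | P? Fin.zero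
... | inj₁ none | no ¬p₀ = inj₁ λ { Fin.zero → ¬p₀ ; (Fin.suc x) → none x }
... | inj₁ none | yes p₀ =
  inj₂ (Fin.zero , p₀ , λ { Fin.zero _ → refl′ ; (Fin.suc x) px → ⊥-elim (none x px) })
... | inj₂ (m , pm , max) | no ¬p₀ =
  inj₂ (Fin.suc m , pm , λ { Fin.zero p₀ → ⊥-elim (¬p₀ p₀) ; (Fin.suc x) px → max x px })
... | inj₂ (m , pm , max) | yes p₀ with total Fin.zero (Fin.suc m) p₀ pm
...   | inj₁ r = inj₂ (Fin.suc m , pm , λ { Fin.zero _ → r ; (Fin.suc x) px → max x px })
...   | inj₂ r =
  inj₂ (Fin.zero , p₀ , λ { Fin.zero _ → refl′ ; (Fin.suc x) px → trans′ (max x px) r })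

greatest : ∀ {k} (P : Fin k → Set) → Decidable P → (R : Fin k → Fin k → Set) →
  Reflexive R → Transitive R → (∀ x y → P x → P y → R x y ⊎ R y x) →
  ∃ P → Greatest P R
greatest P P? R refl′ trans′ total (x , px) =
  [ (λ none → ⊥-elim (none x px)) , id ] (greatest-or-empty P P? R refl′ trans′ total)

module RootedTreeProperties {m : ℕ} (T : RootedTree m) where
  open RootedTree T

  private variable a b c p q y : Fin m

  parent-unique : parent b ≡ just p → parent b ≡ just q → p ≡ q
  parent-unique e e′ = just-injective (Eq.trans (sym e) e′)

  ⊏-parent : a ⊏ b → ∃ λ p → parent b ≡ just p × a ⊑ p
  ⊏-parent (step e) = _ , e , inj₁ refl
  ⊏-parent (trans h e) = _ , e , inj₂ h

  ⊏⇒⊑-parent : a ⊏ b → parent b ≡ just p → a ⊑ p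
  ⊏⇒⊑-parent h e with ⊏-parent h
  ... | _ , e′ , a⊑p′ with parent-unique e e′
  ... | refl = a⊑p′

  ⊑-parent⇒⊏ : a ⊑ p → parent b ≡ just p → a ⊏ b
  ⊑-parent⇒⊏ (inj₁ refl) e = step e
  ⊑-parent⇒⊏ (inj₂ h) e = trans h e

  ⊏-trans : a ⊏ b → b ⊏ c → a ⊏ c
  ⊏-trans h (step e) = trans h e
  ⊏-trans h (trans h′ e) = trans (⊏-trans h h′) e

  ⊑-⊏-trans : a ⊑ b → b ⊏ c → a ⊏ c
  ⊑-⊏-trans (inj₁ refl) h = h
  ⊑-⊏-trans (inj₂ h′) h = ⊏-trans h′ h

  ⊏-⊑-trans : a ⊏ b → b ⊑ c → a ⊏ c
  ⊏-⊑-trans h (inj₁ refl) = h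
  ⊏-⊑-trans h (inj₂ h′) = ⊏-trans h h′

  ⊑-trans : a ⊑ b → b ⊑ c → a ⊑ c
  ⊑-trans (inj₁ refl) h = h
  ⊑-trans (inj₂ h) h′ = inj₂ (⊏-⊑-trans h h′)

  ⊏-root : ¬ (a ⊏ root)
  ⊏-root h with ⊏-parent h
  ... | _ , e , _ with Eq.trans (sym root-parent) e
  ... | ()

  ⊏-irrefl : ¬ (a ⊏ a)
  ⊏-irrefl {a} cycle with reach a
  ... | inj₁ refl = ⊏-root cycle
  ... | inj₂ root⊏a = go root⊏a cycle
    where
    -- a cycle through b also runs through the parent of b, so it climbs up to the root
    go : root ⊏ b → ¬ (b ⊏ b)
    go (step e) cycle = ⊏-root (⊏-⊑-trans (step e) (⊏⇒⊑-parent cycle e))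
    go (trans h e) cycle = go h (⊏-⊑-trans (step e) (⊏⇒⊑-parent cycle e))

  ⊏-comparable : a ⊏ c → b ⊏ c → a ⊑ b ⊎ b ⊑ a
  ⊏-comparable (step e) hb = inj₂ (⊏⇒⊑-parent hb e)
  ⊏-comparable (trans ha e) hb with ⊏⇒⊑-parent hb e
  ... | inj₁ refl = inj₁ (inj₂ ha)
  ... | inj₂ hb′ = ⊏-comparable ha hb′

  ⊑-comparable : a ⊑ c → b ⊑ c → a ⊑ b ⊎ b ⊑ a
  ⊑-comparable (inj₁ refl) hb = inj₂ hb
  ⊑-comparable (inj₂ ha) (inj₁ refl) = inj₁ (inj₂ ha)
  ⊑-comparable (inj₂ ha) (inj₂ hb) = ⊏-comparable ha hb

  leaf-or-child : ∀ t → IsLeaf t ⊎ ∃ λ s → parent s ≡ just t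
  leaf-or-child t with any? (λ s → Maybe-≡-dec _≟_ (parent s) (just t))
  ... | yes child = inj₂ child
  ... | no ¬child = inj₁ λ s e → ¬child (s , e)

  step-down : Fin m → Fin m
  step-down t with leaf-or-child t
  ... | inj₁ _ = t
  ... | inj₂ (s , _) = s

  ⊑-step-down : ∀ t → t ⊑ step-down t
  ⊑-step-down t with leaf-or-child t
  ... | inj₁ _ = inj₁ refl
  ... | inj₂ (_ , e) = inj₂ (step e)

  leaf-or-step-down : ∀ t → IsLeaf t ⊎ parent (step-down t) ≡ just t
  leaf-or-step-down t with leaf-or-child t
  ... | inj₁ leaf = inj₁ leaf
  ... | inj₂ (_ , e) = inj₂ e

  descend : ℕ → Fin m → Fin m
  descend k b = fold b step-down k

  ⊑-descend : ∀ b k → b ⊑ descend k b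
  ⊑-descend b zero = inj₁ refl
  ⊑-descend b (suc k) = ⊑-trans (⊑-descend b k) (⊑-step-down (descend k b))

  LeafBelow : Fin m → Set
  LeafBelow b = ∃ λ l → IsLeaf l × b ⊑ l

  leaf-below-or-descend-⊏ : ∀ b {i j} → i < j → LeafBelow b ⊎ descend i b ⊏ descend j b
  leaf-below-or-descend-⊏ b {i} {suc j} (s≤s i≤j) with leaf-or-step-down (descend j b)
  ... | inj₁ leaf = inj₁ (_ , leaf , ⊑-descend b j)
  ... | inj₂ e with m≤n⇒m<n∨m≡n i≤j
  ...   | inj₂ refl = inj₂ (step e)
  ...   | inj₁ i<j = Sum.map₂ (λ h → trans h e) (leaf-below-or-descend-⊏ b i<j)

  -- m + 1 descent steps must repeat a node, which would be a cycle unless a leaf was reached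
  leaf-below : ∀ b → LeafBelow b
  leaf-below b with pigeonhole (n<1+n m) (λ i → descend (toℕ i) b)
  ... | i , j , i<j , eq =
    [ id , (λ h → ⊥-elim (⊏-irrefl (subst (descend (toℕ i) b ⊏_) (sym eq) h))) ]
      (leaf-below-or-descend-⊏ b i<j)

  IsRootLeafSubpath-convex : ∀ {S} → IsRootLeafSubpath S →
    S a → S c → a ⊑ b → b ⊑ c → S b
  IsRootLeafSubpath-convex (_ , _ , _ , _ , _ , _ , S⇔) sa sc a⊑b b⊑c =
    Equivalence.from (S⇔ _)
      ( ⊑-trans (proj₁ (Equivalence.to (S⇔ _) sa)) a⊑b
      , ⊑-trans b⊑c (proj₂ (Equivalence.to (S⇔ _) sc)))

  module _ {S : Fin m → Set} where

    walk-head : WalkIn S a b → S a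
    walk-head (here s) = s
    walk-head (cons s _ _) = s

    TEdge-sym : TEdge a b → TEdge b a
    TEdge-sym = Sum.swap

    walk-snoc : WalkIn S a b → TEdge b c → S c → WalkIn S a c
    walk-snoc (here s) e sc = cons s e (here sc)
    walk-snoc (cons s e w) e′ sc = cons s e (walk-snoc w e′ sc)

    walk-reverse : WalkIn S a b → WalkIn S b a
    walk-reverse (here s) = here s
    walk-reverse (cons s e w) = walk-snoc (walk-reverse w) (TEdge-sym e) s

    walk-++ : WalkIn S a b → WalkIn S b c → WalkIn S a c
    walk-++ (here _) w = w
    walk-++ (cons s e w) w′ = cons s e (walk-++ w w′)

    walk-up : a ⊏ b → (∀ t → a ⊑ t → t ⊑ b → S t) → WalkIn S b a
    walk-up {a} {b} (step e) S-between =
      cons (S-between b (inj₂ (step e)) (inj₁ refl)) (inj₁ e)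
        (here (S-between a (inj₁ refl) (inj₂ (step e))))
    walk-up {b = b} (trans h e) S-between =
      cons (S-between b (inj₂ (trans h e)) (inj₁ refl)) (inj₁ e)
        (walk-up h (λ t a⊑t t⊑p → S-between t a⊑t (inj₂ (⊑-parent⇒⊏ t⊑p e))))

    walk-into-subtree : WalkIn S a b → y ⊑ b → y ⊑ a ⊎ S y
    walk-into-subtree (here _) y⊑b = inj₁ y⊑b
    walk-into-subtree (cons _ e w) y⊑b with walk-into-subtree w y⊑b
    ... | inj₂ sy = inj₂ sy
    ... | inj₁ y⊑a′ with e
    ...   | inj₁ up = inj₁ (inj₂ (⊑-parent⇒⊏ y⊑a′ up))
    ...   | inj₂ down with y⊑a′
    ...     | inj₁ refl = inj₂ (walk-head w)
    ...     | inj₂ y⊏a′ = inj₁ (⊏⇒⊑-parent y⊏a′ down)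

    walk-visits-between : WalkIn S a c → a ⊏ b → b ⊏ c → S b
    walk-visits-between w a⊏b b⊏c with walk-into-subtree w (inj₂ b⊏c)
    ... | inj₁ b⊑a = ⊥-elim (⊏-irrefl (⊏-⊑-trans a⊏b b⊑a))
    ... | inj₂ sb = sb

module CliqueProperties {n : ℕ} (G : Graph n) where
  open Graph G using (adj; irrefl) renaming (sym to adj-sym)

  private variable u v x y : Fin n

  adj-flip : adj x y ≡ true → adj y x ≡ true
  adj-flip {x} {y} e = Eq.trans (adj-sym y x) e

  adj⇒≢ : adj x y ≡ true → x ≢ y
  adj⇒≢ {x} e refl with Eq.trans (sym (irrefl x)) e
  ... | ()

  ClosedNbhd⇒adj : ClosedNbhd G v u → u ≢ v → adj v u ≡ true
  ClosedNbhd⇒adj (inj₁ u≡v) u≢v = ⊥-elim (u≢v u≡v)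
  ClosedNbhd⇒adj (inj₂ e) _ = e

  _⊆N[_] : Subset n → Fin n → Set
  K ⊆N[ v ] = ∀ u → u ∈ K → ClosedNbhd G v u

  _⊆N[_]? : ∀ K v → Dec (K ⊆N[ v ])
  K ⊆N[ v ]? = all? λ u → (u ∈? K) →-dec ((u ≟ v) ⊎-dec (adj v u Bool.≟ true))

  ⁅⁆-clique : ∀ v → IsClique G ⁅ v ⁆
  ⁅⁆-clique v x y x∈ y∈ x≢y =
    ⊥-elim (x≢y (Eq.trans (x∈⁅y⁆⇒x≡y v x∈) (sym (x∈⁅y⁆⇒x≡y v y∈))))

  ∪⁅⁆-clique : ∀ {K} → IsClique G K → K ⊆N[ v ] → IsClique G (K ∪ ⁅ v ⁆)
  ∪⁅⁆-clique {v} {K} K-clique K⊆N[v] x y x∈ y∈ =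
    go (members x∈) (members y∈)
    where
    members : ∀ {x} → x ∈ K ∪ ⁅ v ⁆ → x ∈ K ⊎ x ≡ v
    members = Sum.map₂ (x∈⁅y⁆⇒x≡y v) ∘ x∈p∪q⁻ K ⁅ v ⁆
    go : x ∈ K ⊎ x ≡ v → y ∈ K ⊎ y ≡ v → x ≢ y → adj x y ≡ true
    go (inj₁ x∈K) (inj₁ y∈K) = K-clique x y x∈K y∈K
    go (inj₁ x∈K) (inj₂ refl) x≢v = adj-flip (ClosedNbhd⇒adj (K⊆N[v] x x∈K) x≢v)
    go (inj₂ refl) (inj₁ y∈K) v≢y = ClosedNbhd⇒adj (K⊆N[v] y y∈K) (v≢y ∘ sym)
    go (inj₂ refl) (inj₂ refl) v≢v = ⊥-elim (v≢v refl)

  clique-⊆N : ∀ {K} → IsClique G K → v ∈ K → u ∈ K → ClosedNbhd G v u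
  clique-⊆N {v} {u} K-clique v∈K u∈K with u ≟ v
  ... | yes u≡v = inj₁ u≡v
  ... | no u≢v = inj₂ (K-clique v u v∈K u∈K (u≢v ∘ sym))

  maximal-clique-absorbs : ∀ {K} → IsMaximalClique G K → K ⊆N[ v ] → v ∈ K
  maximal-clique-absorbs {v} {K} (K-clique , K-maximal) K⊆N[v] =
    K-maximal (K ∪ ⁅ v ⁆) (∪⁅⁆-clique K-clique K⊆N[v]) (p⊆p∪q ⁅ v ⁆)
      (x∈p∪q⁺ (inj₂ (x∈⁅x⁆ v)))

  maximal-clique-nonempty : ∀ {K} → IsMaximalClique G K → Fin n → ∃ (_∈ K)
  maximal-clique-nonempty {K} K-maximal v with any? (_∈? K)
  ... | yes nonempty = nonempty
  ... | no empty = v , maximal-clique-absorbs K-maximal (λ u u∈K → ⊥-elim (empty (u , u∈K)))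

  extend-by : ∀ v K → Dec (K ⊆N[ v ]) → Subset n
  extend-by v K (yes _) = K ∪ ⁅ v ⁆
  extend-by v K (no _) = K

  greedy : List (Fin n) → Subset n → Subset n
  greedy [] K = K
  greedy (v ∷ vs) K = greedy vs (extend-by v K (K ⊆N[ v ]?))

  ⊆-extend-by : ∀ v K d → K ⊆ extend-by v K d
  ⊆-extend-by v K (yes _) = p⊆p∪q ⁅ v ⁆
  ⊆-extend-by v K (no _) = id

  extend-by-clique : ∀ v K d → IsClique G K → IsClique G (extend-by v K d)
  extend-by-clique v K (yes K⊆N[v]) K-clique = ∪⁅⁆-clique K-clique K⊆N[v]
  extend-by-clique v K (no _) K-clique = K-clique

  ⊆-greedy : ∀ vs K → K ⊆ greedy vs K
  ⊆-greedy [] K = id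
  ⊆-greedy (v ∷ vs) K = ⊆-greedy vs _ ∘ ⊆-extend-by v K (K ⊆N[ v ]?)

  greedy-clique : ∀ vs K → IsClique G K → IsClique G (greedy vs K)
  greedy-clique [] K = id
  greedy-clique (v ∷ vs) K = greedy-clique vs _ ∘ extend-by-clique v K (K ⊆N[ v ]?)

  -- when v was considered, the partial clique lay inside K′ ∋ v, so v was added
  greedy-saturated : ∀ vs K → v List.∈ vs →
    ∀ K′ → IsClique G K′ → greedy vs K ⊆ K′ → v ∈ K′ → v ∈ greedy vs K
  greedy-saturated (_ ∷ vs) K (there v∈vs) K′ = greedy-saturated vs _ v∈vs K′
  greedy-saturated (v ∷ vs) K (here refl) K′ K′-clique greedy⊆K′ v∈K′ with K ⊆N[ v ]?
  ... | yes _ = ⊆-greedy vs _ (x∈p∪q⁺ (inj₂ (x∈⁅x⁆ v)))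
  ... | no ¬K⊆N[v] =
    ⊥-elim (¬K⊆N[v] λ u u∈K → clique-⊆N K′-clique v∈K′ (greedy⊆K′ (⊆-greedy vs K u∈K)))

  extend-to-maximal-clique : ∀ {C} → IsClique G C → ∃ λ K → IsMaximalClique G K × C ⊆ K
  extend-to-maximal-clique {C} C-clique =
    greedy (allFin n) C ,
    (greedy-clique (allFin n) C C-clique ,
      λ K′ K′-clique greedy⊆K′ {v} →
        greedy-saturated (allFin n) C (∈-allFin v) K′ K′-clique greedy⊆K′) ,
    ⊆-greedy (allFin n) C

module TreeLayoutProperties {n : ℕ} {G : Graph n} (L : TreeLayout G) where
  open Graph G using (adj)
  open TreeLayout L
  open RootedTreeProperties T
  open CliqueProperties G

  private variable v w x y z : Fin n

  ρ-injective : ρ x ≡ ρ y → x ≡ y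
  ρ-injective = proj₁ ρ-bij

  ∀-node : (Q : Fin n → Set) → (∀ w → Q (ρ w)) → ∀ t → Q t
  ∀-node Q Q∘ρ t = subst Q (proj₂ (proj₂ ρ-bij t) refl) (Q∘ρ (proj₁ (proj₂ ρ-bij t)))

  ∀-between : ∀ {S : Fin n → Set} {a b} →
    (∀ w → a ⊑ ρ w → ρ w ⊑ b → S (ρ w)) → ∀ t → a ⊑ t → t ⊑ b → S t
  ∀-between {S} {a} {b} = ∀-node (λ t → a ⊑ t → t ⊑ b → S t)

  Image⁺ : ∀ {P} → P x → Image P (ρ x)
  Image⁺ px = _ , px , refl

  Image⁻ : ∀ {P} → Image P (ρ x) → P x
  Image⁻ {P = P} (_ , pv , eq) = subst P (ρ-injective eq) pv

  ≺⇒≢ : x ≺ y → x ≢ y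
  ≺⇒≢ x≺y refl = ⊏-irrefl x≺y

  adj⇒≺-comparable : adj x y ≡ true → x ≺ y ⊎ y ≺ x
  adj⇒≺-comparable {x} {y} e with edges-comparable x y e
  ... | inj₁ (inj₂ x≺y) = inj₁ x≺y
  ... | inj₂ (inj₂ y≺x) = inj₂ y≺x
  ... | inj₁ (inj₁ eq) = ⊥-elim (adj⇒≢ e (ρ-injective eq))
  ... | inj₂ (inj₁ eq) = ⊥-elim (adj⇒≢ e (ρ-injective (sym eq)))

  clique-comparable : ∀ {K} → IsClique G K →
    ∀ u v → u ∈ K → v ∈ K → ρ u ⊑ ρ v ⊎ ρ v ⊑ ρ u
  clique-comparable K-clique u v u∈K v∈K with u ≟ v
  ... | yes refl = inj₁ (inj₁ refl)
  ... | no u≢v = edges-comparable u v (K-clique u v u∈K v∈K u≢v)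

  clique-extremes : ∀ {K} → IsClique G K → ∃ (_∈ K) →
    ∃₂ λ ka kb → ka ∈ K × kb ∈ K × (∀ k → k ∈ K → ρ ka ⊑ ρ k × ρ k ⊑ ρ kb)
  clique-extremes {K} K-clique nonempty
    with greatest (_∈ K) (_∈? K) (λ u v → ρ v ⊑ ρ u) (inj₁ refl) (λ p q → ⊑-trans q p)
           (λ u v u∈K v∈K → clique-comparable K-clique v u v∈K u∈K) nonempty
       | greatest (_∈ K) (_∈? K) (λ u v → ρ u ⊑ ρ v) (inj₁ refl) ⊑-trans
           (clique-comparable K-clique) nonempty
  ... | ka , ka∈K , above-ka | kb , kb∈K , below-kb =
    ka , kb , ka∈K , kb∈K , λ k k∈K → above-ka k k∈K , below-kb k k∈K

  module _ (indifference : IsIndifference G L) where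

    ≺-⊑-adj : x ≺ y → ρ y ⊑ ρ z → adj x z ≡ true → adj x y ≡ true
    ≺-⊑-adj {x} (_) (inj₁ eq) e = subst (λ v → adj x v ≡ true) (sym (ρ-injective eq)) e
    ≺-⊑-adj x≺y (inj₂ y≺z) e = proj₁ (indifference _ _ _ x≺y y≺z e)

    ⊑-≺-adj : ρ x ⊑ ρ y → y ≺ z → adj x z ≡ true → adj y z ≡ true
    ⊑-≺-adj {z = z} (inj₁ eq) _ e = subst (λ v → adj v z ≡ true) (ρ-injective eq) e
    ⊑-≺-adj (inj₂ x≺y) y≺z e = proj₂ (indifference _ _ _ x≺y y≺z e)

    N[]-below-neighbour : adj x v ≡ true → ρ x ⊑ ρ w → ρ w ⊑ ρ v → ClosedNbhd G x w
    N[]-below-neighbour _ (inj₁ eq) _ = inj₁ (sym (ρ-injective eq))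
    N[]-below-neighbour x~v (inj₂ x≺w) w⊑v = inj₂ (≺-⊑-adj x≺w w⊑v x~v)

    N[]-above-neighbour : adj x v ≡ true → ρ v ⊑ ρ w → ρ w ⊑ ρ x → ClosedNbhd G x w
    N[]-above-neighbour _ _ (inj₁ eq) = inj₁ (ρ-injective eq)
    N[]-above-neighbour x~v v⊑w (inj₂ w≺x) = inj₂ (adj-flip (⊑-≺-adj v⊑w w≺x (adj-flip x~v)))

    walk-to-centre : ∀ v → ClosedNbhd G x v → WalkIn (Image (ClosedNbhd G x)) (ρ v) (ρ x)
    walk-to-centre _ (inj₁ refl) = here (Image⁺ (inj₁ refl))
    walk-to-centre v (inj₂ x~v) with adj⇒≺-comparable x~v
    ... | inj₁ x≺v =
      walk-up x≺v (∀-between λ w x⊑w w⊑v → Image⁺ (N[]-below-neighbour x~v x⊑w w⊑v))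
    ... | inj₂ v≺x =
      walk-reverse (walk-up v≺x (∀-between λ w v⊑w w⊑x → Image⁺ (N[]-above-neighbour x~v v⊑w w⊑x)))

    clique-interval-⊆N : ∀ {K ka kb} → IsClique G K → ka ∈ K → kb ∈ K →
      (∀ k → k ∈ K → ρ ka ⊑ ρ k × ρ k ⊑ ρ kb) → ρ ka ⊑ ρ w → ρ w ⊑ ρ kb → K ⊆N[ w ]
    clique-interval-⊆N K-clique ka∈K kb∈K bounds ka⊑w w⊑kb k k∈K
      with ⊑-comparable (proj₂ (bounds k k∈K)) w⊑kb
    ... | inj₁ (inj₁ eq) = inj₁ (ρ-injective eq)
    ... | inj₂ (inj₁ eq) = inj₁ (sym (ρ-injective eq))
    ... | inj₁ (inj₂ k≺w) =
      inj₂ (adj-flip (≺-⊑-adj k≺w w⊑kb (K-clique _ _ k∈K kb∈K (≺⇒≢ (⊏-⊑-trans k≺w w⊑kb)))))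
    ... | inj₂ (inj₂ w≺k) =
      inj₂ (⊑-≺-adj ka⊑w w≺k (K-clique _ _ ka∈K k∈K (≺⇒≢ (⊑-⊏-trans ka⊑w w≺k))))

    indifference⇒Cond2 : Cond2 G L
    indifference⇒Cond2 x =
      (ρ x , Image⁺ (inj₁ refl)) ,
      λ { _ _ (u , x~u , refl) (v , x~v , refl) →
            walk-++ (walk-to-centre u x~u) (walk-reverse (walk-to-centre v x~v)) }

    indifference⇒Cond3 : Cond3 G L
    indifference⇒Cond3 K K-maximal@(K-clique , _)
      with clique-extremes K-clique (maximal-clique-nonempty K-maximal root)
    ... | ka , kb , ka∈K , kb∈K , bounds with leaf-below (ρ kb)
    ... | l , l-leaf , kb⊑l =
      l , ρ ka , ρ kb , l-leaf , proj₁ (bounds kb kb∈K) , kb⊑l , λ t → mk⇔ to (from t)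
      where
      to : ∀ {t} → Image (_∈ K) t → ρ ka ⊑ t × t ⊑ ρ kb
      to (k , k∈K , refl) = bounds k k∈K
      from : ∀ t → ρ ka ⊑ t × t ⊑ ρ kb → Image (_∈ K) t
      from t (ka⊑t , t⊑kb) = ∀-between {S = Image (_∈ K)} in-K t ka⊑t t⊑kb
        where
        in-K : ∀ w → ρ ka ⊑ ρ w → ρ w ⊑ ρ kb → Image (_∈ K) (ρ w)
        in-K w ka⊑w w⊑kb = Image⁺ (maximal-clique-absorbs K-maximal
                                     (clique-interval-⊆N K-clique ka∈K kb∈K bounds ka⊑w w⊑kb))

    indifference⇒Cond4 : Cond4 G L
    indifference⇒Cond4 x y x≺y =
      (λ { z (y~z , z≺x) →
             adj-flip (proj₁ (indifference z x y z≺x x≺y (adj-flip y~z))) , z≺x }) ,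
      (λ { z (x~z , y≺z) → proj₂ (indifference x y z x≺y y≺z x~z) , y≺z })

  Cond2⇒indifference : Cond2 G L → IsIndifference G L
  Cond2⇒indifference cond2 x y z x≺y y≺z x~z =
    ClosedNbhd⇒adj (between x (inj₁ refl) (inj₂ x~z)) (≺⇒≢ x≺y ∘ sym) ,
    adj-flip (ClosedNbhd⇒adj (between z (inj₂ (adj-flip x~z)) (inj₁ refl)) (≺⇒≢ y≺z))
    where
    -- every walk from ρ x down to ρ z passes through ρ y
    between : ∀ u → ClosedNbhd G u x → ClosedNbhd G u z → ClosedNbhd G u y
    between u u~x u~z =
      Image⁻ (walk-visits-between (proj₂ (cond2 u) _ _ (Image⁺ u~x) (Image⁺ u~z)) x≺y y≺z)

  Cond3⇒indifference : Cond3 G L → IsIndifference G L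
  Cond3⇒indifference cond3 x y z x≺y y≺z x~z with extend-to-maximal-clique pair-clique
    where
    pair-clique : IsClique G (⁅ x ⁆ ∪ ⁅ z ⁆)
    pair-clique = ∪⁅⁆-clique (⁅⁆-clique x) λ u u∈⁅x⁆ →
      inj₂ (subst (λ u → adj z u ≡ true) (sym (x∈⁅y⁆⇒x≡y x u∈⁅x⁆)) (adj-flip x~z))
  ... | K , K-maximal@(K-clique , _) , pair⊆K =
    K-clique x y x∈K y∈K (≺⇒≢ x≺y) , K-clique y z y∈K z∈K (≺⇒≢ y≺z)
    where
    x∈K = pair⊆K (x∈p∪q⁺ (inj₁ (x∈⁅x⁆ x)))
    z∈K = pair⊆K (x∈p∪q⁺ (inj₂ (x∈⁅x⁆ z)))
    y∈K : y ∈ K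
    y∈K = Image⁻ (IsRootLeafSubpath-convex (cond3 K K-maximal)
                    (Image⁺ x∈K) (Image⁺ z∈K) (inj₂ x≺y) (inj₂ y≺z))

  Cond4⇒indifference : Cond4 G L → IsIndifference G L
  Cond4⇒indifference cond4 x y z x≺y y≺z x~z =
    adj-flip (proj₁ (proj₁ (cond4 y z y≺z) x (adj-flip x~z , x≺y))) ,
    proj₁ (proj₂ (cond4 x y x≺y) z (x~z , y≺z))

mainTheorem2 : {n : ℕ} (G : Graph n) (L : TreeLayout G) →
    (IsIndifference G L ⇔ Cond2 G L) ×
    (IsIndifference G L ⇔ Cond3 G L) ×
    (IsIndifference G L ⇔ Cond4 G L)
mainTheorem2 G L =
  mk⇔ indifference⇒Cond2 Cond2⇒indifference ,
  mk⇔ indifference⇒Cond3 Cond3⇒indifference ,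
  mk⇔ indifference⇒Cond4 Cond4⇒indifference
  where open TreeLayoutProperties L
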